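{- Let $\mathcal P$ be a finite projective plane of order $m^2$, let $\ell_\infty$ be a line of $\mathcal P$, and let $\mathfrak T$ be the translation group of $\mathcal P$ with respect to $\ell_\infty$ (the group of all elations of $\mathcal P$ with axis $\ell_\infty$), and suppose $\mathfrak T$ is non-trivial. If $\mathcal P$ contains a unital $U$ of order $m$ such that $\mathrm{Aut}(U)\cap\mathfrak T$ is non-trivial, then $U$ is a parabolic unital, i.e. $\ell_\infty$ is a tangent line of $U$.
   Context: A unital of order $m$ in $\mathcal P$ is a set of $m^3+1$ points such that every line meets it in $1$ point (tangent) or $m+1$ points (secant). $\mathrm{Aut}(U)$ is the group of collineations of $\mathcal P$ mapping $U$ onto itself. -}

module Defs where

open import Data.Nat using (ℕ; zero; suc; _+_; _*_; _^_)
open import Data.Bool using (Bool; true; false)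
open import Data.Fin using (Fin)
import Data.Fin as F
import Data.Bool
open import Data.Fin.Permutation using (Permutation′; _⟨$⟩ʳ_)
open import Data.Product using (Σ; ∃; _×_; _,_)
open import Data.Sum using (_⊎_)
open import Relation.Binary.PropositionalEquality using (_≡_; _≢_)
open import Relation.Nullary using (¬_)

count : ∀ {n} → (Fin n → Bool) → ℕ
count {zero} P = 0
count {suc n} P with P F.zero
... | true  = suc (count (λ i → P (F.suc i)))
... | false = count (λ i → P (F.suc i))

record ProjectivePlane (n : ℕ) : Set where
  field
    #pts  : ℕ
    #lns  : ℕ
    _∈ₗ_  : Fin #pts → Fin #lns → Bool

  Point = Fin #pts
  Line  = Fin #lns

  On : Point → Line → Set
  On x L = (x ∈ₗ L) ≡ true

  Collinear : Point → Point → Point → Set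
  Collinear x y z = ∃ λ L → On x L × On y L × On z L

  field
    join       : ∀ (x y : Point) → x ≢ y → ∃ λ L → On x L × On y L
    join-uniq  : ∀ (x y : Point) (L M : Line) → x ≢ y →
                 On x L → On y L → On x M → On y M → L ≡ M
    meet       : ∀ (L M : Line) → L ≢ M → ∃ λ x → On x L × On x M
    quadrangle : Σ Point λ a → Σ Point λ b → Σ Point λ c → Σ Point λ d →
                 ¬ Collinear a b c × ¬ Collinear a b d ×
                 ¬ Collinear a c d × ¬ Collinear b c d
    order      : ∀ (L : Line) → count (λ x → x ∈ₗ L) ≡ suc n

module _ {n : ℕ} (𝒫 : ProjectivePlane n) where
  open ProjectivePlane 𝒫

  record Collineation : Set where
    field
      σ : Permutation′ #pts
      τ : Permutation′ #lns
      preserves : ∀ (x : Point) (L : Line) → ((σ ⟨$⟩ʳ x) ∈ₗ (τ ⟨$⟩ʳ L)) ≡ (x ∈ₗ L)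

  open Collineation public

  -- an elation with axis ℓ∞ (the identity included): fixes every point of
  -- ℓ∞ and has a centre c on ℓ∞ such that every line through c is fixed
  IsElationWithAxis : Line → Collineation → Set
  IsElationWithAxis ℓ∞ g =
    (∀ (x : Point) → On x ℓ∞ → σ g ⟨$⟩ʳ x ≡ x) ×
    (Σ Point λ c → On c ℓ∞ × (∀ (L : Line) → On c L → τ g ⟨$⟩ʳ L ≡ L))

  NonTrivial : Collineation → Set
  NonTrivial g = ∃ λ (x : Point) → σ g ⟨$⟩ʳ x ≢ x

  TranslationGroupNonTrivial : Line → Set
  TranslationGroupNonTrivial ℓ∞ =
    ∃ λ g → IsElationWithAxis ℓ∞ g × NonTrivial g

  meetCount : (Point → Bool) → Line → ℕ
  meetCount U L = count (λ x → Data.Bool._∧_ (U x) (x ∈ₗ L))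

  IsUnital : ℕ → (Point → Bool) → Set
  IsUnital m U = count U ≡ m ^ 3 + 1 ×
    (∀ (L : Line) → meetCount U L ≡ 1 ⊎ meetCount U L ≡ m + 1)

  -- g ∈ Aut(U): g maps U onto U (g is a bijection on points)
  Stabilizes : (Point → Bool) → Collineation → Set
  Stabilizes U g = ∀ (x : Point) → U (σ g ⟨$⟩ʳ x) ≡ U x

  AutMeetTranslationsNonTrivial : Line → (Point → Bool) → Set
  AutMeetTranslationsNonTrivial ℓ∞ U =
    ∃ λ g → IsElationWithAxis ℓ∞ g × Stabilizes U g × NonTrivial g

  IsTangent : (Point → Bool) → Line → Set
  IsTangent U L = meetCount U L ≡ 1

{-# OPTIONS --safe #-}
-- Suppose ℓ∞ were a secant of U and let g ≠ 1 be an elation in Aut(U) with axis ℓ∞ and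
-- centre c. Pick d ∈ U ∩ ℓ∞ other than c. The m² + 1 lines through d partition the m³
-- points of U ∖ {d}, and each of them carries either 0 or m of those points, so exactly
-- one line T through d is a tangent. As g fixes d and preserves tangency, g fixes T; as
-- c ∉ T, each point of T is the meet of T with a (fixed) line through c, so g fixes T
-- pointwise. A collineation fixing two lines pointwise is trivial once lines have at
-- least three points, i.e. for m ≥ 2; order 1 is excluded by the quadrangle axiom, and
-- for m = 0 every line is a tangent.
module Submission where

open import Data.Bool using (Bool; true; false; _∧_; not)
open import Data.Bool.Properties using (∧-assoc; not-¬)
open import Data.Empty using (⊥-elim)
open import Data.Fin using (Fin; zero; suc)
open import Data.Fin.Properties using (_≟_)
open import Data.Fin.Permutation using (Permutation′; _⟨$⟩ʳ_)
open import Data.Nat using (ℕ; zero; suc; _+_; _*_; _^_; _≤_; _<_; z≤n; s≤s; >-nonZero)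
open import Data.Nat.Properties renaming (_≟_ to _≟ℕ_)
open import Data.Product using (∃; _×_; _,_; proj₁; proj₂)
open import Data.Sum using (_⊎_; inj₁; inj₂)
open import Function using (_∘_)
open import Relation.Binary.PropositionalEquality
open import Relation.Nullary using (¬_; does; yes; no)
open import Relation.Nullary.Decidable using (dec-true; dec-false)
open import Algebra.Properties.Semiring.Sum +-*-semiring
  using (sum; sum-cong-≗; ∑-comm; ∑-distrib-+; sum-permute; *-distribˡ-sum)
open import Algebra.Properties.CommutativeSemigroup +-commutativeSemigroup
  using () renaming (x∙yz≈y∙xz to +-exchange)
open import Algebra.Properties.CommutativeSemigroup *-commutativeSemigroup
  using () renaming (x∙yz≈y∙xz to *-exchange)

open import Defs

⟦_⟧ : Bool → ℕ
⟦ true  ⟧ = 1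
⟦ false ⟧ = 0

⟦∧⟧ : ∀ a b → ⟦ a ∧ b ⟧ ≡ ⟦ a ⟧ * ⟦ b ⟧
⟦∧⟧ true  b = sym (+-identityʳ ⟦ b ⟧)
⟦∧⟧ false b = refl

⟦⟧≤1 : ∀ a → ⟦ a ⟧ ≤ 1
⟦⟧≤1 true  = s≤s z≤n
⟦⟧≤1 false = z≤n

⟦⟧-exchange : ∀ a b c → ⟦ a ⟧ * ⟦ b ∧ c ⟧ ≡ ⟦ b ⟧ * ⟦ a ∧ c ⟧
⟦⟧-exchange a b c = begin
  ⟦ a ⟧ * ⟦ b ∧ c ⟧        ≡⟨ cong (⟦ a ⟧ *_) (⟦∧⟧ b c) ⟩
  ⟦ a ⟧ * (⟦ b ⟧ * ⟦ c ⟧)  ≡⟨ *-exchange ⟦ a ⟧ ⟦ b ⟧ ⟦ c ⟧ ⟩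
  ⟦ b ⟧ * (⟦ a ⟧ * ⟦ c ⟧)  ≡⟨ cong (⟦ b ⟧ *_) (⟦∧⟧ a c) ⟨
  ⟦ b ⟧ * ⟦ a ∧ c ⟧        ∎
  where open ≡-Reasoning

∧-intro : ∀ {a b} → a ≡ true → b ≡ true → a ∧ b ≡ true
∧-intro refl b≡true = b≡true

∧-elim : ∀ {a b} → a ∧ b ≡ true → a ≡ true × b ≡ true
∧-elim {true} b≡true = refl , b≡true

count-suc : ∀ {n : ℕ} (P : Fin (suc n) → Bool) → count P ≡ ⟦ P zero ⟧ + count (P ∘ suc)
count-suc P with P zero
... | true  = refl
... | false = refl

count≡sum : ∀ {n} (P : Fin n → Bool) → count P ≡ sum (⟦_⟧ ∘ P)
count≡sum {zero}  P = refl
count≡sum {suc n} P = trans (count-suc P) (cong (⟦ P zero ⟧ +_) (count≡sum (P ∘ suc)))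

count-cong : ∀ {n} {P Q : Fin n → Bool} → (∀ x → P x ≡ Q x) → count P ≡ count Q
count-cong {P = P} {Q} P≗Q = begin
  count P           ≡⟨ count≡sum P ⟩
  sum (⟦_⟧ ∘ P)     ≡⟨ sum-cong-≗ (cong ⟦_⟧ ∘ P≗Q) ⟩
  sum (⟦_⟧ ∘ Q)     ≡⟨ count≡sum Q ⟨
  count Q           ∎
  where open ≡-Reasoning

count-permute : ∀ {n} (P : Fin n → Bool) (π : Permutation′ n) →
                count (λ x → P (π ⟨$⟩ʳ x)) ≡ count P
count-permute P π = begin
  count (λ x → P (π ⟨$⟩ʳ x))    ≡⟨ count≡sum (λ x → P (π ⟨$⟩ʳ x)) ⟩
  sum (λ x → ⟦ P (π ⟨$⟩ʳ x) ⟧)  ≡⟨ sum-permute (⟦_⟧ ∘ P) π ⟨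
  sum (⟦_⟧ ∘ P)                 ≡⟨ count≡sum P ⟨
  count P                       ∎
  where open ≡-Reasoning

count-none : ∀ {n} {P : Fin n → Bool} → (∀ x → P x ≡ false) → count P ≡ 0
count-none {zero}  P≗false = refl
count-none {suc n} {P} P≗false rewrite count-suc P | P≗false zero = count-none (P≗false ∘ suc)

count-witness : ∀ {n} (P : Fin n → Bool) → 0 < count P → ∃ λ x → P x ≡ true
count-witness {suc n} P pos with P zero in eq
... | true  = zero , eq
... | false = let x , Px = count-witness (P ∘ suc) pos in suc x , Px

-- The test x ≟ a comes first since _∧_ computes on its left argument; thus P ∖ a reduces
-- on points headed by constructors.
infixl 6 _∖_
_∖_ : ∀ {n} → (Fin n → Bool) → Fin n → Fin n → Bool
(P ∖ a) x = not (does (x ≟ a)) ∧ P x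

∖-intro : ∀ {n} (P : Fin n → Bool) {a x} → P x ≡ true → x ≢ a → (P ∖ a) x ≡ true
∖-intro P {x = x} Px x≢a rewrite dec-false (x ≟ _) x≢a = Px

∖-elim : ∀ {n} (P : Fin n → Bool) {a x} → (P ∖ a) x ≡ true → P x ≡ true × x ≢ a
∖-elim P {a} {x} P∖ax with x ≟ a
... | yes _   = ⊥-elim (not-¬ refl P∖ax)
... | no x≢a = P∖ax , x≢a

∖-self : ∀ {n} (P : Fin n → Bool) a → (P ∖ a) a ≡ false
∖-self P a rewrite dec-true (a ≟ a) refl = refl

count-∖ : ∀ {n} (P : Fin n → Bool) a → count P ≡ ⟦ P a ⟧ + count (P ∖ a)
count-∖ P zero    = trans (count-suc P) (cong (⟦ P zero ⟧ +_) (sym (count-suc (P ∖ zero))))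
count-∖ P (suc a) = begin
  count P
    ≡⟨ count-suc P ⟩
  ⟦ P zero ⟧ + count (P ∘ suc)
    ≡⟨ cong (⟦ P zero ⟧ +_) (count-∖ (P ∘ suc) a) ⟩
  ⟦ P zero ⟧ + (⟦ P (suc a) ⟧ + count ((P ∘ suc) ∖ a))
    ≡⟨ +-exchange ⟦ P zero ⟧ ⟦ P (suc a) ⟧ _ ⟩
  ⟦ P (suc a) ⟧ + (⟦ P zero ⟧ + count ((P ∘ suc) ∖ a))
    ≡⟨ cong (⟦ P (suc a) ⟧ +_) (count-suc (P ∖ suc a)) ⟨
  ⟦ P (suc a) ⟧ + count (P ∖ suc a) ∎
  where open ≡-Reasoning

count-∖-member : ∀ {n} (P : Fin n → Bool) {a} → P a ≡ true → count P ≡ suc (count (P ∖ a))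
count-∖-member P {a} Pa = trans (count-∖ P a) (cong (λ b → ⟦ b ⟧ + count (P ∖ a)) Pa)

count-∖-≥ : ∀ {n k} (P : Fin n → Bool) a → suc k ≤ count P → k ≤ count (P ∖ a)
count-∖-≥ P a k<count = +-cancelˡ-≤ 1 _ _ (begin
  suc _                     ≤⟨ k<count ⟩
  count P                   ≡⟨ count-∖ P a ⟩
  ⟦ P a ⟧ + count (P ∖ a)   ≤⟨ +-monoˡ-≤ _ (⟦⟧≤1 (P a)) ⟩
  1 + count (P ∖ a)         ∎)
  where open ≤-Reasoning

count-witness-≢ : ∀ {n} (P : Fin n → Bool) → 2 ≤ count P → ∀ a → ∃ λ x → P x ≡ true × x ≢ a
count-witness-≢ P 2≤count a =
  let x , P∖ax = count-witness (P ∖ a) (count-∖-≥ P a 2≤count) in x , ∖-elim P P∖ax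

count-positive : ∀ {n} (P : Fin n → Bool) {x} → P x ≡ true → 0 < count P
count-positive P Px rewrite count-∖-member P Px = s≤s z≤n

count≡1 : ∀ {n} (P : Fin n → Bool) x → P x ≡ true → (∀ y → P y ≡ true → y ≡ x) → count P ≡ 1
count≡1 P x Px unique = trans (count-∖-member P Px) (cong suc (count-none none))
  where
  none : ∀ y → (P ∖ x) y ≡ false
  none y with y ≟ x | P y in Py
  ... | yes _   | _     = refl
  ... | no  y≢x | true  = ⊥-elim (y≢x (unique y Py))
  ... | no  _   | false = refl

count≡1-unique : ∀ {n} (P : Fin n → Bool) → count P ≡ 1 → ∀ {x y} → P x ≡ true → P y ≡ true → x ≡ y
count≡1-unique P count≡1 {x} {y} Px Py with y ≟ x
... | yes y≡x = sym y≡x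
... | no  y≢x = ⊥-elim (<⇒≢ (count-positive (P ∖ x) (∖-intro P Py y≢x)) (sym rest≡0))
  where
  rest≡0 : count (P ∖ x) ≡ 0
  rest≡0 = suc-injective (trans (sym (count-∖-member P Px)) count≡1)

count≡2-cases : ∀ {n} (P : Fin n → Bool) → count P ≡ 2 → ∀ {a b x} →
                P a ≡ true → P b ≡ true → a ≢ b → P x ≡ true → x ≡ a ⊎ x ≡ b
count≡2-cases P count≡2 {a} {x = x} Pa Pb a≢b Px with x ≟ a
... | yes x≡a = inj₁ x≡a
... | no  x≢a = inj₂ (count≡1-unique (P ∖ a) rest≡1 (∖-intro P Px x≢a) (∖-intro P Pb (a≢b ∘ sym)))
  where
  rest≡1 : count (P ∖ a) ≡ 1
  rest≡1 = suc-injective (trans (sym (count-∖-member P Pa)) count≡2)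

module Plane {n : ℕ} (𝒫 : ProjectivePlane n) where
  open ProjectivePlane 𝒫

  off-≢ : ∀ {x y L} → ¬ On x L → On y L → x ≢ y
  off-≢ x∉L yL refl = x∉L yL

  meet-uniq : ∀ {L M x y} → L ≢ M → On x L → On x M → On y L → On y M → x ≡ y
  meet-uniq {L} {M} {x} {y} L≢M xL xM yL yM with x ≟ y
  ... | yes x≡y = x≡y
  ... | no  x≢y = ⊥-elim (L≢M (join-uniq x y L M x≢y xL yL xM yM))

  line-avoiding : ∀ {ℓ c d y} → On c ℓ → On d ℓ → d ≢ c → ¬ On y ℓ → ∃ λ M → ¬ On d M
  line-avoiding {ℓ} {c} {d} {y} cℓ dℓ d≢c y∉ℓ with join c y (off-≢ y∉ℓ cℓ ∘ sym)
  ... | M , cM , yM = M , λ dM → y∉ℓ (subst (On y) (join-uniq c d M ℓ (d≢c ∘ sym) cM dM cℓ dℓ) yM)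

  line-through-both : Line → ∀ x y → ∃ λ L → On x L × On y L
  line-through-both ℓ x y with x ≟ y
  ... | no x≢y = join x y x≢y
  ... | yes refl with count-witness (_∈ₗ ℓ) (subst (0 <_) (sym (order ℓ)) (s≤s z≤n))
  ...   | p , pℓ with x ≟ p
  ...     | yes refl = ℓ , pℓ , pℓ
  ...     | no  x≢p  = let L , xL , _ = join x p x≢p in L , xL , xL

  noncollinear-≢₁₂ : Line → ∀ {x y z} → ¬ Collinear x y z → x ≢ y
  noncollinear-≢₁₂ ℓ {x} {z = z} ¬xyz refl =
    let L , xL , zL = line-through-both ℓ x z in ¬xyz (L , xL , xL , zL)

  noncollinear-≢₂₃ : Line → ∀ {x y z} → ¬ Collinear x y z → y ≢ z
  noncollinear-≢₂₃ ℓ {x} {y} ¬xyz refl =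
    let L , xL , yL = line-through-both ℓ x y in ¬xyz (L , xL , yL , yL)

  order≢1 : Line → n ≢ 1
  order≢1 ℓ n≡1 with quadrangle
  ... | a , b , c , d , ¬abc , _ , ¬acd , ¬bcd
    with join a b (noncollinear-≢₁₂ ℓ ¬abc) | join c d (noncollinear-≢₂₃ ℓ ¬acd)
  ...   | L , aL , bL | M , cM , dM
    with meet L M (λ L≡M → ¬abc (L , aL , bL , subst (On c) (sym L≡M) cM))
  ...     | e , eL , eM
    with count≡2-cases (_∈ₗ L) (trans (order L) (cong suc n≡1)) aL bL (noncollinear-≢₁₂ ℓ ¬abc) eL
  ...       | inj₁ refl = ¬acd (M , eM , cM , dM)
  ...       | inj₂ refl = ¬bcd (M , eM , cM , dM)

  lines-through-two : ∀ {x y} → x ≢ y → count (λ L → (x ∈ₗ L) ∧ (y ∈ₗ L)) ≡ 1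
  lines-through-two {x} {y} x≢y =
    let L , xL , yL = join x y x≢y in
    count≡1 _ L (∧-intro xL yL) λ M xyM →
      let xM , yM = ∧-elim xyM in join-uniq x y M L x≢y xM yM xL yL

  points-on-two : ∀ {L M} → L ≢ M → count (λ x → (x ∈ₗ L) ∧ (x ∈ₗ M)) ≡ 1
  points-on-two {L} {M} L≢M =
    let x , xL , xM = meet L M L≢M in
    count≡1 _ x (∧-intro xL xM) λ y yLM →
      let yL , yM = ∧-elim yLM in meet-uniq L≢M yL yM xL xM

  count-by-lines : (A : Line → Bool) (B : Point → Bool) →
                   (∀ x → B x ≡ true → count (λ L → A L ∧ (x ∈ₗ L)) ≡ 1) →
                   sum (λ L → ⟦ A L ⟧ * count (λ x → B x ∧ (x ∈ₗ L))) ≡ count B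
  count-by-lines A B one-line = begin
    sum (λ L → ⟦ A L ⟧ * count (λ x → B x ∧ (x ∈ₗ L)))
      ≡⟨ sum-cong-≗ (λ L → trans (cong (⟦ A L ⟧ *_) (count≡sum (λ x → B x ∧ (x ∈ₗ L))))
                                (*-distribˡ-sum ⟦ A L ⟧ (λ x → ⟦ B x ∧ (x ∈ₗ L) ⟧))) ⟩
    sum (λ L → sum (λ x → ⟦ A L ⟧ * ⟦ B x ∧ (x ∈ₗ L) ⟧))
      ≡⟨ ∑-comm (λ L x → ⟦ A L ⟧ * ⟦ B x ∧ (x ∈ₗ L) ⟧) ⟩
    sum (λ x → sum (λ L → ⟦ A L ⟧ * ⟦ B x ∧ (x ∈ₗ L) ⟧))
      ≡⟨ sum-cong-≗ (λ x → sum-cong-≗ (λ L → ⟦⟧-exchange (A L) (B x) (x ∈ₗ L))) ⟩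
    sum (λ x → sum (λ L → ⟦ B x ⟧ * ⟦ A L ∧ (x ∈ₗ L) ⟧))
      ≡⟨ sum-cong-≗ (λ x → trans (sym (*-distribˡ-sum ⟦ B x ⟧ (λ L → ⟦ A L ∧ (x ∈ₗ L) ⟧)))
                                (on-one-line x)) ⟩
    sum (⟦_⟧ ∘ B)
      ≡⟨ count≡sum B ⟨
    count B ∎
    where
    open ≡-Reasoning
    on-one-line : ∀ x → ⟦ B x ⟧ * sum (λ L → ⟦ A L ∧ (x ∈ₗ L) ⟧) ≡ ⟦ B x ⟧
    on-one-line x with B x in Bx
    ... | false = refl
    ... | true  = trans (+-identityʳ _)
                        (trans (sym (count≡sum (λ L → A L ∧ (x ∈ₗ L)))) (one-line x Bx))

  pencil-size : ∀ {d M} → ¬ On d M → count (d ∈ₗ_) ≡ suc n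
  pencil-size {d} {M} d∉M = begin
    count (d ∈ₗ_)
      ≡⟨ count≡sum (d ∈ₗ_) ⟩
    sum (λ L → ⟦ d ∈ₗ L ⟧)
      ≡⟨ sum-cong-≗ meets-M-once ⟨
    sum (λ L → ⟦ d ∈ₗ L ⟧ * count (λ x → (x ∈ₗ M) ∧ (x ∈ₗ L)))
      ≡⟨ count-by-lines (d ∈ₗ_) (_∈ₗ M) (λ x xM → lines-through-two (off-≢ d∉M xM)) ⟩
    count (_∈ₗ M)
      ≡⟨ order M ⟩
    suc n ∎
    where
    open ≡-Reasoning
    meets-M-once : ∀ L → ⟦ d ∈ₗ L ⟧ * count (λ x → (x ∈ₗ M) ∧ (x ∈ₗ L)) ≡ ⟦ d ∈ₗ L ⟧
    meets-M-once L with d ∈ₗ L in dL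
    ... | false = refl
    ... | true  = trans (+-identityʳ _) (points-on-two λ M≡L → d∉M (subst (On d) (sym M≡L) dL))

  pencil-partition : ∀ d (B : Point → Bool) → B d ≡ false →
                     sum (λ L → ⟦ d ∈ₗ L ⟧ * count (λ x → B x ∧ (x ∈ₗ L))) ≡ count B
  pencil-partition d B Bd = count-by-lines (d ∈ₗ_) B λ x Bx → lines-through-two λ d≡x →
    not-¬ Bd (subst (λ z → B z ≡ true) (sym d≡x) Bx)

  two-points-off-line : 2 ≤ n → ∀ {ℓ T} → ℓ ≢ T →
    ∃ λ a → ∃ λ b → a ≢ b × (On a T × ¬ On a ℓ) × (On b T × ¬ On b ℓ)
  two-points-off-line 2≤n {ℓ} {T} ℓ≢T with meet T ℓ (ℓ≢T ∘ sym)
  ... | d , dT , dℓ =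
    let a , T∖d-a       = count-witness T∖d (≤-trans (s≤s z≤n) T∖d-large)
        b , T∖d-b , b≢a = count-witness-≢ T∖d T∖d-large a
    in a , b , b≢a ∘ sym , off-ℓ T∖d-a , off-ℓ T∖d-b
    where
    T∖d : Point → Bool
    T∖d = (_∈ₗ T) ∖ d
    T∖d-large : 2 ≤ count T∖d
    T∖d-large = count-∖-≥ (_∈ₗ T) d (subst (3 ≤_) (sym (order T)) (s≤s 2≤n))
    off-ℓ : ∀ {x} → T∖d x ≡ true → On x T × ¬ On x ℓ
    off-ℓ T∖d-x = let xT , x≢d = ∖-elim (_∈ₗ T) T∖d-x in
      xT , λ xℓ → x≢d (meet-uniq (ℓ≢T ∘ sym) xT xℓ dT dℓ)

  tangent? : (Point → Bool) → Line → Bool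
  tangent? U L = does (meetCount 𝒫 U L ≟ℕ 1)

  tangent-through? : (Point → Bool) → Point → Line → Bool
  tangent-through? U d L = (d ∈ₗ L) ∧ tangent? U L

  module _ (g : Collineation 𝒫) where

    FixesPoint : Point → Set
    FixesPoint p = σ g ⟨$⟩ʳ p ≡ p

    FixesLine : Line → Set
    FixesLine L = τ g ⟨$⟩ʳ L ≡ L

    FixesPointwise : Line → Set
    FixesPointwise L = ∀ x → On x L → FixesPoint x

    image-on : ∀ {p L} → On p L → On (σ g ⟨$⟩ʳ p) (τ g ⟨$⟩ʳ L)
    image-on {p} {L} pL = trans (preserves g p L) pL

    fixes-meet : ∀ {L M p} → FixesLine L → FixesLine M → L ≢ M → On p L → On p M → FixesPoint p
    fixes-meet gL≡L gM≡M L≢M pL pM =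
      meet-uniq L≢M (subst (On _) gL≡L (image-on pL)) (subst (On _) gM≡M (image-on pM)) pL pM

    fixes-join : ∀ {a b L} → FixesPoint a → FixesPoint b → a ≢ b → On a L → On b L → FixesLine L
    fixes-join {a} {b} {L} ga≡a gb≡b a≢b aL bL = join-uniq a b _ L a≢b
      (subst (λ z → On z _) ga≡a (image-on aL)) (subst (λ z → On z _) gb≡b (image-on bL)) aL bL

    meetCount-image : ∀ {U} → Stabilizes 𝒫 U g → ∀ L → meetCount 𝒫 U (τ g ⟨$⟩ʳ L) ≡ meetCount 𝒫 U L
    meetCount-image {U} stable L = begin
      count (λ x → U x ∧ (x ∈ₗ (τ g ⟨$⟩ʳ L)))
        ≡⟨ count-permute (λ x → U x ∧ (x ∈ₗ (τ g ⟨$⟩ʳ L))) (σ g) ⟨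
      count (λ x → U (σ g ⟨$⟩ʳ x) ∧ ((σ g ⟨$⟩ʳ x) ∈ₗ (τ g ⟨$⟩ʳ L)))
        ≡⟨ count-cong (λ x → cong₂ _∧_ (stable x) (preserves g x L)) ⟩
      count (λ x → U x ∧ (x ∈ₗ L)) ∎
      where open ≡-Reasoning

    tangent?-image : ∀ {U} → Stabilizes 𝒫 U g → ∀ L → tangent? U (τ g ⟨$⟩ʳ L) ≡ tangent? U L
    tangent?-image stable L = cong (λ k → does (k ≟ℕ 1)) (meetCount-image stable L)

    fixes-pointwise-line-off-centre : ∀ {c T} → (∀ L → On c L → FixesLine L) →
      FixesLine T → ¬ On c T → FixesPointwise T
    fixes-pointwise-line-off-centre {c} centre gT≡T c∉T x xT with join c x (off-≢ c∉T xT)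
    ... | M , cM , xM = fixes-meet (centre M cM) gT≡T (λ M≡T → c∉T (subst (On c) M≡T cM)) xM xT

    fixed-line-through : ∀ {ℓ a y} → FixesPointwise ℓ → FixesPoint a → ¬ On a ℓ → ¬ On y ℓ → y ≢ a →
      ∃ λ L → On y L × On a L × FixesLine L
    fixed-line-through {ℓ} {a} {y} gℓ ga≡a a∉ℓ y∉ℓ y≢a with join y a y≢a
    ... | L , yL , aL with meet L ℓ (λ L≡ℓ → y∉ℓ (subst (On y) L≡ℓ yL))
    ...   | e , eL , eℓ = L , yL , aL , fixes-join ga≡a (gℓ e eℓ) (off-≢ a∉ℓ eℓ) aL eL

    fixes-all-points : 2 ≤ n → ∀ {ℓ T} → ℓ ≢ T → FixesPointwise ℓ → FixesPointwise T →
                       ∀ y → FixesPoint y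
    fixes-all-points 2≤n {ℓ} {T} ℓ≢T gℓ gT y with y ∈ₗ ℓ in yℓ | y ∈ₗ T in yT
    ... | true  | _     = gℓ y yℓ
    ... | false | true  = gT y yT
    ... | false | false with two-points-off-line 2≤n ℓ≢T
    ...   | a , b , a≢b , (aT , a∉ℓ) , (bT , b∉ℓ)
          with fixed-line-through gℓ (gT a aT) a∉ℓ (not-¬ yℓ) (off-≢ (not-¬ yT) aT)
             | fixed-line-through gℓ (gT b bT) b∉ℓ (not-¬ yℓ) (off-≢ (not-¬ yT) bT)
    ...     | La , yLa , aLa , gLa≡La | Lb , yLb , bLb , gLb≡Lb =
              fixes-meet gLa≡La gLb≡Lb La≢Lb yLa yLb
      where
      La≢Lb : La ≢ Lb
      La≢Lb refl = not-¬ yT (subst (On y) (join-uniq a b La T a≢b aLa bLb aT bT) yLa)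

module Unital {m : ℕ} {𝒫 : ProjectivePlane (m ^ 2)} {U : ProjectivePlane.Point 𝒫 → Bool}
              (unital : IsUnital 𝒫 m U) (0<m : 0 < m) where
  open ProjectivePlane 𝒫
  open Plane 𝒫

  secant-not-tangent : ∀ {L} → meetCount 𝒫 U L ≡ m + 1 → tangent? U L ≡ false
  secant-not-tangent secant =
    dec-false (_ ≟ℕ 1) λ tangent → >⇒≢ 0<m (+-cancelʳ-≡ 1 m 0 (trans (sym secant) tangent))

  count-U∖ : ∀ {d} → U d ≡ true → count (U ∖ d) ≡ m ^ 3
  count-U∖ Ud = suc-injective (trans (sym (count-∖-member U Ud)) (trans (proj₁ unital) (+-comm (m ^ 3) 1)))

  module _ {d : Point} (Ud : U d ≡ true) where

    others-on : Line → ℕ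
    others-on L = count (λ x → (U ∖ d) x ∧ (x ∈ₗ L))

    meetCount-through : ∀ {L} → On d L → meetCount 𝒫 U L ≡ suc (others-on L)
    meetCount-through {L} dL = begin
      count (λ x → U x ∧ (x ∈ₗ L))
        ≡⟨ count-∖ (λ x → U x ∧ (x ∈ₗ L)) d ⟩
      ⟦ U d ∧ (d ∈ₗ L) ⟧ + count ((λ x → U x ∧ (x ∈ₗ L)) ∖ d)
        ≡⟨ cong₂ _+_ (cong ⟦_⟧ (∧-intro Ud dL)) (count-cong λ x → sym (∧-assoc _ (U x) (x ∈ₗ L))) ⟩
      suc (others-on L) ∎
      where open ≡-Reasoning

    others-on-through : ∀ {L} → On d L → others-on L + m * ⟦ tangent? U L ⟧ ≡ m
    others-on-through {L} dL with proj₂ unital L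
    ... | inj₁ tangent rewrite dec-true (meetCount 𝒫 U L ≟ℕ 1) tangent =
      cong₂ _+_ (suc-injective (trans (sym (meetCount-through dL)) tangent)) (*-identityʳ m)
    ... | inj₂ secant rewrite secant-not-tangent secant =
      trans (cong₂ _+_ (suc-injective (trans (sym (meetCount-through dL)) (trans secant (+-comm m 1))))
                       (*-zeroʳ m))
            (+-identityʳ m)

    others-on-weighted : ∀ L →
      ⟦ d ∈ₗ L ⟧ * others-on L + m * ⟦ tangent-through? U d L ⟧ ≡ m * ⟦ d ∈ₗ L ⟧
    others-on-weighted L with d ∈ₗ L in dL
    ... | false = refl
    ... | true  = trans (cong (_+ m * ⟦ tangent? U L ⟧) (*-identityˡ (others-on L)))
                        (trans (others-on-through dL) (sym (*-identityʳ m)))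

    unique-tangent-through : ∀ {M} → ¬ On d M → count (tangent-through? U d) ≡ 1
    unique-tangent-through d∉M =
      *-cancelˡ-≡ _ 1 m {{>-nonZero 0<m}} (+-cancelˡ-≡ (m ^ 3) _ _ (begin
      m ^ 3 + m * count (tangent-through? U d)
        ≡⟨ cong₂ _+_ (sym (count-U∖ Ud)) (cong (m *_) (count≡sum (tangent-through? U d))) ⟩
      count (U ∖ d) + m * sum (⟦_⟧ ∘ (tangent-through? U d))
        ≡⟨ cong₂ _+_ (sym (pencil-partition d (U ∖ d) (∖-self U d)))
                     (*-distribˡ-sum m (⟦_⟧ ∘ (tangent-through? U d))) ⟩
      sum (λ L → ⟦ d ∈ₗ L ⟧ * others-on L) + sum (λ L → m * ⟦ tangent-through? U d L ⟧)
        ≡⟨ ∑-distrib-+ (λ L → ⟦ d ∈ₗ L ⟧ * others-on L) (λ L → m * ⟦ tangent-through? U d L ⟧) ⟨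
      sum (λ L → ⟦ d ∈ₗ L ⟧ * others-on L + m * ⟦ tangent-through? U d L ⟧)
        ≡⟨ sum-cong-≗ others-on-weighted ⟩
      sum (λ L → m * ⟦ d ∈ₗ L ⟧)
        ≡⟨ *-distribˡ-sum m (λ L → ⟦ d ∈ₗ L ⟧) ⟨
      m * sum (λ L → ⟦ d ∈ₗ L ⟧)
        ≡⟨ cong (m *_) (trans (sym (count≡sum (d ∈ₗ_))) (pencil-size d∉M)) ⟩
      m * suc (m ^ 2)
        ≡⟨ *-suc m (m ^ 2) ⟩
      m + m ^ 3
        ≡⟨ +-comm m (m ^ 3) ⟩
      m ^ 3 + m
        ≡⟨ cong (m ^ 3 +_) (*-identityʳ m) ⟨
      m ^ 3 + m * 1 ∎))
      where open ≡-Reasoning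

    fixed-tangent-through : ∀ {M} g → ¬ On d M → Stabilizes 𝒫 U g → FixesPoint g d →
      ∃ λ T → On d T × tangent? U T ≡ true × FixesLine g T
    fixed-tangent-through g d∉M stable gd≡d
      with count-witness (tangent-through? U d) (≤-reflexive (sym (unique-tangent-through d∉M)))
    ... | T , dT-tangent with ∧-elim dT-tangent
    ...   | dT , T-tangent = T , dT , T-tangent ,
      count≡1-unique (tangent-through? U d) (unique-tangent-through d∉M)
        (∧-intro (subst (λ z → On z (τ g ⟨$⟩ʳ T)) gd≡d (image-on g dT))
                 (trans (tangent?-image g stable T) T-tangent))
        dT-tangent

1<m⇒2≤m² : ∀ {m} → 1 < m → 2 ≤ m ^ 2
1<m⇒2≤m² (s≤s (s≤s _)) = s≤s (s≤s z≤n)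

module _ {m : ℕ} {𝒫 : ProjectivePlane (m ^ 2)} {U : ProjectivePlane.Point 𝒫 → Bool}
         (unital : IsUnital 𝒫 m U) (1<m : 1 < m) where
  open ProjectivePlane 𝒫
  open Plane 𝒫
  open Unital {𝒫 = 𝒫} {U} unital (<⇒≤ 1<m)

  stabilizing-translation-trivial-if-secant : ∀ {ℓ∞} g → IsElationWithAxis 𝒫 ℓ∞ g → Stabilizes 𝒫 U g →
    meetCount 𝒫 U ℓ∞ ≡ m + 1 → ¬ NonTrivial 𝒫 g
  stabilizing-translation-trivial-if-secant {ℓ∞} g (axis , c , cℓ , centre) stable secant (y , gy≢y)
    with count-witness-≢ (λ x → U x ∧ (x ∈ₗ ℓ∞)) (subst (2 ≤_) (sym secant) (+-monoˡ-≤ 1 (<⇒≤ 1<m))) c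
  ... | d , dUℓ , d≢c with ∧-elim dUℓ
  ...   | Ud , dℓ with line-avoiding cℓ dℓ d≢c (gy≢y ∘ axis y)
  ...     | M , d∉M with fixed-tangent-through Ud g d∉M stable (axis d dℓ)
  ...       | T , dT , T-tangent , gT≡T = gy≢y (fixes-all-points g (1<m⇒2≤m² 1<m) ℓ∞≢T axis T-fixed y)
    where
    ℓ∞≢T : ℓ∞ ≢ T
    ℓ∞≢T ℓ∞≡T = not-¬ (secant-not-tangent secant)
                      (subst (λ L → tangent? U L ≡ true) (sym ℓ∞≡T) T-tangent)
    T-fixed : FixesPointwise g T
    T-fixed = fixes-pointwise-line-off-centre g centre gT≡T λ cT →
      ℓ∞≢T (join-uniq c d ℓ∞ T (d≢c ∘ sym) cℓ dℓ cT dT)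

corollary4p2 : (m : ℕ) (𝒫 : ProjectivePlane (m ^ 2))
    (ℓ∞ : ProjectivePlane.Line 𝒫) →
    TranslationGroupNonTrivial 𝒫 ℓ∞ →
    (U : ProjectivePlane.Point 𝒫 → Bool) →
    IsUnital 𝒫 m U →
    AutMeetTranslationsNonTrivial 𝒫 ℓ∞ U →
    IsTangent 𝒫 U ℓ∞
corollary4p2 zero          𝒫 ℓ∞ _ U unital _ with proj₂ unital ℓ∞
... | inj₁ tangent = tangent
... | inj₂ secant  = secant
corollary4p2 (suc zero)    𝒫 ℓ∞ _ U _ _ = ⊥-elim (Plane.order≢1 𝒫 ℓ∞ refl)
corollary4p2 (suc (suc k)) 𝒫 ℓ∞ _ U unital (g , elation , stable , nontrivial) with proj₂ unital ℓ∞
... | inj₁ tangent = tangent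
... | inj₂ secant  = ⊥-elim
  (stabilizing-translation-trivial-if-secant unital (s≤s (s≤s z≤n)) g elation stable secant nontrivial)
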